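{- Let $W$ be a topological space, $A$ a non-empty open subset of $W$, and $\mathscr{C}$ the closure subalgebra of $2^W$ generated by $A$. Then $\mathscr{C}\cong\mathscr{E}(P)$ (as closure algebras), where $P=P(\infty)$ or $P=P(m,n)$ for some $(m,n)\in J$, and, indexing each atom of $\mathscr{C}$ by the element $p$ of $P$ such that the atom corresponds to $\{p\}$ under this isomorphism (and indexing $A_\infty$ by $\bot$): (i) if $A_\infty=\emptyset$, the atoms of $\mathscr{C}$ form a complete trim $P$-partition of $W$; (ii) if $A_\infty\neq\emptyset$, the atoms of $\mathscr{C}$ together with $A_\infty$ form a complete trim $\widetilde{P(\infty)}$-partition of $W$.
   Context: A closure algebra is a Boolean algebra with an operator $x\mapsto\overline{x}$ satisfying $x\subseteq\overline x$, $\overline{\overline x}=\overline x$, $\overline{x\cup y}=\overline x\cup\overline y$, $\overline{0}=0$; for a topological space $W$, $2^W$ is a closure algebra with topological closure. For a poset $P$ (topologised so that lower sets are the closed sets), $\mathscr{E}(P)$ is the closure subalgebra of $2^P$ generated by the lower subsets of $P$, with closure $Q\mapsto\{p\in P: p\le q \text{ for some } q\in Q\}$. $P(\infty)$ is the poset $\{p_k\mid k\ge0\}$ with $p_j>p_k$ iff $k\ge j+2$; $\widetilde{P(\infty)}=P(\infty)\cup\{\bot\}$ with the additional relations $p_k>\bot$ for all $k$. $J=\mathbb{N}\times\{0,2\}$ (with $0\in\mathbb N$); for $m\ge0$, $P(m,0)=\{p_0,\dots,p_m\}$ and $P(m,2)=P(m,0)\cup\{p_{m+2}\}$, with the order inherited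 from $P(\infty)$. For $A\subseteq W$, $A_\infty=W-\bigcup\{B: B$ an atom of the closure subalgebra of $2^W$ generated by $A\}$. Partition notions: for a poset $P$ and topological space $W$, a $P$-partition is a family $\{X_p\mid p\in P\}$ of pairwise disjoint non-empty subsets of $W$; complete if their union is $W$. For $Y\subseteq W$, $T(Y)=\{p: Y\cap X_p\ne\emptyset\}$; an open $A$ is $p$-trim ($t(A)=p$) if $T(A)=\{q: q\ge p\}$, trim if $p$-trim for some $p$. $\widehat P$ is the set of $p$ for which a $p$-trim set exists. The partition is semi-trim if every point of $W$ has a neighbourhood base of trim sets; if $A$ open and $p\in T(A)\cap\widehat P$ then $A$ contains a $p$-trim subset; if $x\in X_p$ then $p=\sup\{t(A): A\text{ trim}, x\in A\}$; and every point with a neighbourhood base of $p$-trim sets lies in $X_p$. It is trim if moreover every $x\in X_p$ has a $p$-trim neighbourhood. -}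

module Defs where

open import Level using (Level; 0ℓ) renaming (suc to lsuc)
open import Data.Nat using (ℕ; zero; suc; _+_; _≤_)
open import Data.Fin using (Fin; toℕ)
open import Data.Maybe using (Maybe; just; nothing)
open import Data.Empty using (⊥)
open import Data.Unit using (⊤)
open import Data.Product using (Σ; ∃; _×_; _,_; proj₁)
open import Data.Sum using (_⊎_)
open import Relation.Binary.PropositionalEquality using (_≡_)
open import Relation.Unary using (Pred; _∪_; _∩_; ∁; _⊆_; _≐_; Empty; Satisfiable; U; ∅)

record Topology (W : Set) : Set₁ where
  field
    Ix    : Set
    op    : Ix → Pred W 0ℓ
    U-open : ∃ λ i → op i ≐ U
    ∩-open : ∀ i j → ∃ λ k → op k ≐ (op i ∩ op j)
    ⋃-open : (I : Set) (f : I → Ix) →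
             ∃ λ k → op k ≐ (λ w → ∃ λ i → op (f i) w)
open Topology public

module _ {W : Set} (T : Topology W) where

  IsOpen : Pred W 0ℓ → Set
  IsOpen A = ∃ λ i → op T i ≐ A

  cl : Pred W 0ℓ → Pred W 0ℓ
  cl Y w = ∀ i → op T i w → Satisfiable (op T i ∩ Y)

-- Closure subalgebra generated by a family of subsets: the subsets
-- denoted by terms built from the generators by 0, complement, union
-- and closure (membership is up to extensional equality).

data Term {ℓ : Level} (G : Set ℓ) : Set ℓ where
  gen   : G → Term G
  zero  : Term G
  compl : Term G → Term G
  union : Term G → Term G → Term G
  clos  : Term G → Term G

module _ {ℓ : Level} {X : Set} {G : Set ℓ}
         (clo : Pred X 0ℓ → Pred X 0ℓ) (g : G → Pred X 0ℓ) where

  eval : Term G → Pred X 0ℓ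
  eval (gen a)     = g a
  eval zero        = ∅
  eval (compl t)   = ∁ (eval t)
  eval (union s t) = eval s ∪ eval t
  eval (clos t)    = clo (eval t)

  InGen : Pred X 0ℓ → Set ℓ
  InGen Y = ∃ λ t → eval t ≐ Y

  IsAtom : Pred X 0ℓ → Set ℓ
  IsAtom B = InGen B × Satisfiable B ×
             (∀ t → eval t ⊆ B → Empty (eval t) ⊎ B ⊆ eval t)

module _ {W : Set} (T : Topology W) (A : Pred W 0ℓ) where

  InC : Pred W 0ℓ → Set
  InC = InGen {G = ⊤} (cl T) (λ _ → A)

  evalC : Term ⊤ → Pred W 0ℓ
  evalC = eval (cl T) (λ _ → A)

  Ainf : Pred W 0ℓ
  Ainf w = ¬' (∃ λ t → IsAtom {G = ⊤} (cl T) (λ _ → A) (evalC t) × evalC t w)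
    where
    ¬' : Set → Set
    ¬' P = P → ⊥

-- The posets P(∞), P(m,0), P(m,2)  (with J = ℕ × {0,2}).

data N02 : Set where
  n0 n2 : N02

data Shape : Set where
  pinf : Shape
  pfin : ℕ → N02 → Shape

Carrier : Shape → Set
Carrier pinf          = ℕ
Carrier (pfin m n0)   = Fin (suc m)
Carrier (pfin m n2)   = Maybe (Fin (suc m))   -- nothing ↦ p_(m+2)

idx : (s : Shape) → Carrier s → ℕ
idx pinf k = k
idx (pfin m n0) i = toℕ i
idx (pfin m n2) (just i) = toℕ i
idx (pfin m n2) nothing = suc (suc m)

-- order inherited from P(∞):  p_j > p_k iff k ≥ j + 2
_≤P_ : {s : Shape} → Carrier s → Carrier s → Set
_≤P_ {s} p q = p ≡ q ⊎ idx s q + 2 ≤ idx s p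

-- P ∪ {⊥} with ⊥ below everything (for s = pinf this is P̃(∞))
_≤~_ : {s : Shape} → Maybe (Carrier s) → Maybe (Carrier s) → Set
nothing ≤~ _      = ⊤
just p  ≤~ nothing = ⊥
just p  ≤~ just q  = p ≤P q

extend : {s : Shape} {W : Set} → (Carrier s → Pred W 0ℓ) → Pred W 0ℓ →
         Maybe (Carrier s) → Pred W 0ℓ
extend X B nothing  = B
extend X B (just p) = X p

-- 𝓔(P): closure subalgebra of 2^P generated by the lower sets,
-- closure = down-closure.
down : {s : Shape} → Pred (Carrier s) 0ℓ → Pred (Carrier s) 0ℓ
down Q p = ∃ λ q → Q q × p ≤P q

IsLower : {s : Shape} → Pred (Carrier s) 0ℓ → Set
IsLower L = ∀ p q → L q → p ≤P q → L p

InE : (s : Shape) → Pred (Carrier s) 0ℓ → Set₁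
InE s = InGen {G = Σ (Pred (Carrier s) 0ℓ) IsLower} down proj₁

record IsCAIso {W : Set} (T : Topology W) (A : Pred W 0ℓ) (s : Shape)
               (f : Pred W 0ℓ → Pred (Carrier s) 0ℓ) : Set₁ where
  field
    into     : ∀ X → InC T A X → InE s (f X)
    resp     : ∀ X Y → InC T A X → InC T A Y → X ≐ Y → f X ≐ f Y
    inj      : ∀ X Y → InC T A X → InC T A Y → f X ≐ f Y → X ≐ Y
    surj     : ∀ Q → InE s Q → ∃ λ X → InC T A X × f X ≐ Q
    pres-∪   : ∀ X Y → InC T A X → InC T A Y → f (X ∪ Y) ≐ (f X ∪ f Y)
    pres-∁   : ∀ X → InC T A X → f (∁ X) ≐ ∁ (f X)
    pres-cl  : ∀ X → InC T A X → f (cl T X) ≐ down (f X)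

module _ {W : Set} (T : Topology W) {I : Set} (_≤_ : I → I → Set)
         (X : I → Pred W 0ℓ) where

  IsPartition : Set
  IsPartition = (∀ p → Satisfiable (X p)) ×
                (∀ p q w → X p w → X q w → p ≡ q)

  IsComplete : Set
  IsComplete = ∀ w → ∃ λ p → X p w

  Tset : Pred W 0ℓ → Pred I 0ℓ
  Tset Y p = Satisfiable (Y ∩ X p)

  IsTrimAt : I → Pred W 0ℓ → Set
  IsTrimAt p A = IsOpen T A × (∀ q → (Tset A q → p ≤ q) × (p ≤ q → Tset A q))

  IsTrim : Pred W 0ℓ → Set
  IsTrim A = ∃ λ p → IsTrimAt p A

  Hat : Pred I (lsuc 0ℓ)
  Hat p = ∃ λ A → IsTrimAt p A

  IsLUB : {ℓ : Level} → Pred I ℓ → I → Set ℓ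
  IsLUB S p = (∀ q → S q → q ≤ p) × (∀ r → (∀ q → S q → q ≤ r) → p ≤ r)

  IsSemiTrim : Set₁
  IsSemiTrim =
    (∀ w i → op T i w → ∃ λ B → IsTrim B × B w × B ⊆ op T i) ×
    (∀ A p → IsOpen T A → Tset A p → Hat p → ∃ λ B → IsTrimAt p B × B ⊆ A) ×
    (∀ w p → X p w → IsLUB (λ q → ∃ λ B → IsTrimAt q B × B w) p) ×
    (∀ w p → (∀ i → op T i w → ∃ λ B → IsTrimAt p B × B w × B ⊆ op T i)
           → X p w)

  IsTrimPartition : Set₁
  IsTrimPartition = IsPartition × IsSemiTrim ×
                    (∀ w p → X p w → ∃ λ B → IsTrimAt p B × B w)

  IsCompleteTrimPartition : Set₁
  IsCompleteTrimPartition = IsComplete × IsTrimPartition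

{-# OPTIONS --safe #-}
module Submission where

-- The sets X_0 = A, X_1 = W − cl A, X_{k+2} = cl X_k − (cl X_{k+1} ∪ X_k) and the remainder
-- Rest = W − ⋃ X_k partition W, indexed by P̃(∞) (X_k ↦ p_k, Rest ↦ ⊥), so that X_i ⊆ cl X_j
-- whenever i ≤ j, while X_0 lies in the open set A and X_{k+1} in W − cl X_k, which meet
-- only the pieces above. Hence every member of 𝒞 is the union of the pieces indexed by the
-- same term evaluated in 𝓔(P̃(∞)); these subsets contain ⊥ iff they contain all p_k of large
-- index, so a member of 𝒞 is determined by the nonempty X_k it meets. The nonempty X_k are
-- indexed by P(∞) or by some P(m,n) (once X_{m+1} = ∅, only X_{m+2} can survive beyond m),
-- Z ↦ { p : Z meets X_p } is the isomorphism onto 𝓔(P), the X_k are the atoms, Rest is A_∞,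
-- and the open sets above are the trim neighbourhoods.

open import Defs
open import Level using (0ℓ)
open import Axiom.ExcludedMiddle using (ExcludedMiddle)
open import Axiom.DoubleNegationElimination using (em⇒dne)
open import Data.Product using (Σ; ∃; _×_; _,_; proj₁; proj₂; map₂)
import Data.Product as Product
open import Data.Sum using (_⊎_; inj₁; inj₂)
import Data.Sum as Sum
open import Data.Empty using (⊥-elim)
open import Data.Unit using (⊤; tt)
open import Data.Fin using (Fin; toℕ; fromℕ<)
open import Data.Fin.Properties using (toℕ-injective; toℕ<n; toℕ-fromℕ<)
open import Data.Maybe using (Maybe; just; nothing)
open import Data.Maybe.Properties using (just-injective)
open import Data.Nat using (ℕ; zero; suc; _+_; _⊔_; _≤_; _<_; _≤?_; _<?_; z≤n; s≤s)
open import Data.Nat.Properties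
open import Relation.Nullary using (¬_; Dec; yes; no)
open import Relation.Binary.PropositionalEquality
open import Relation.Binary using (tri<; tri≈; tri>)
open import Relation.Unary using (Pred; _≐_; Empty; Satisfiable; _⊆_; _∩_; _∪_; ∁; U; ｛_｝)
open import Relation.Unary.Properties using (≐-refl; ≐-sym; ≐-trans)

all-upto-or-first-gap : (P : ℕ → Set) → (∀ n → Dec (P n)) → P 0 → ∀ n →
  (∀ j → j ≤ n → P j) ⊎ ∃ λ m → (∀ j → j ≤ m → P j) × ¬ P (suc m)
all-upto-or-first-gap P P? P0 zero = inj₁ λ { zero _ → P0 }
all-upto-or-first-gap P P? P0 (suc n) with all-upto-or-first-gap P P? P0 n
... | inj₂ gap = inj₂ gap
... | inj₁ all-upto with P? (suc n)
...   | no ¬P = inj₂ (n , all-upto , ¬P)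
...   | yes Pn = inj₁ λ j j≤1+n → Sum.[ (λ j<1+n → all-upto j (≤-pred j<1+n)) , (λ { refl → Pn }) ]
                                    (m≤n⇒m<n∨m≡n j≤1+n)

∁-resp-≐ : ∀ {A : Set} {P Q : Pred A 0ℓ} → P ≐ Q → ∁ P ≐ ∁ Q
∁-resp-≐ (P⊆Q , Q⊆P) = (λ ¬p q → ¬p (Q⊆P q)) , (λ ¬q p → ¬q (P⊆Q p))

∪-resp-≐ : ∀ {A : Set} {P Q R S : Pred A 0ℓ} → P ≐ Q → R ≐ S → P ∪ R ≐ Q ∪ S
∪-resp-≐ (P⊆Q , Q⊆P) (R⊆S , S⊆R) = Sum.map P⊆Q R⊆S , Sum.map Q⊆P S⊆R

module ClosureProperties {W : Set} (T : Topology W) where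

  cl-extensive : ∀ {Y} → Y ⊆ cl T Y
  cl-extensive {x = w} y i o = w , o , y

  cl-monotone : ∀ {Y Z} → Y ⊆ Z → cl T Y ⊆ cl T Z
  cl-monotone Y⊆Z c i o = map₂ (map₂ Y⊆Z) (c i o)

  cl-resp-≐ : ∀ {Y Z} → Y ≐ Z → cl T Y ≐ cl T Z
  cl-resp-≐ (Y⊆Z , Z⊆Y) = cl-monotone Y⊆Z , cl-monotone Z⊆Y

  cl-idempotent : ∀ {Y} → cl T (cl T Y) ⊆ cl T Y
  cl-idempotent c i o = let _ , ov , cv = c i o in cv i ov

  cl⇒satisfiable : ∀ {Y w} → cl T Y w → Satisfiable Y
  cl⇒satisfiable c = let i , i≐U = U-open T
                         v , _ , yv = c i (proj₂ i≐U tt)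
                     in v , yv

  open-avoids⇒cl-avoids : ∀ {O Y} → IsOpen T O → O ⊆ ∁ Y → O ⊆ ∁ (cl T Y)
  open-avoids⇒cl-avoids (i , i≐O) O⊆∁Y ow cw =
    let v , oiv , yv = cw i (proj₂ i≐O ow) in O⊆∁Y (proj₁ i≐O oiv) yv

  -- the complement of cl Y is the union of all open sets avoiding Y
  ∁-cl-open : ExcludedMiddle 0ℓ → ∀ Y → IsOpen T (∁ (cl T Y))
  ∁-cl-open em Y with ⋃-open T (Σ (Ix T) λ i → op T i ⊆ ∁ Y) proj₁
  ... | k , k≐⋃ = k , to , from
    where
    dne : {P : Set} → ¬ ¬ P → P
    dne = em⇒dne em
    to : op T k ⊆ ∁ (cl T Y)
    to kw cw = let (i , i⊆∁Y) , iw = proj₁ k≐⋃ kw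
                   _ , iv , yv = cw i iw
               in i⊆∁Y iv yv
    from : ∁ (cl T Y) ⊆ op T k
    from w∉clY = proj₂ k≐⋃ (dne λ ∄ → w∉clY λ i iw →
      dne λ ¬meets → ∄ ((i , λ {v} iv yv → ¬meets (v , iv , yv)) , iw))

module TrimCriterion {W : Set} (T : Topology W) {I : Set} (_⊑_ : I → I → Set)
  (Z : I → Pred W 0ℓ)
  (Z-nonempty : ∀ i → Satisfiable (Z i))
  (Z-complete : IsComplete T _⊑_ Z)
  (⊑-antisym : ∀ {i j} → i ⊑ j → j ⊑ i → i ≡ j)
  (star : I → Pred W 0ℓ)
  (star-open : ∀ i → IsOpen T (star i))
  (Z⊆star : ∀ i → Z i ⊆ star i)
  (star-meets⇒⊑ : ∀ {i j w} → star i w → Z j w → i ⊑ j)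
  (⊑⇒⊆cl : ∀ {i j} → i ⊑ j → Z i ⊆ cl T (Z j))
  where

  ⊑-refl : ∀ i → i ⊑ i
  ⊑-refl i = let w , zi = Z-nonempty i in star-meets⇒⊑ (Z⊆star i zi) zi

  Z-disjoint : ∀ i j w → Z i w → Z j w → i ≡ j
  Z-disjoint i j w zi zj =
    ⊑-antisym (star-meets⇒⊑ (Z⊆star i zi) zj) (star-meets⇒⊑ (Z⊆star j zj) zi)

  open-in-star⇒trim : ∀ {i} k → op T k ⊆ star i → Tset T _⊑_ Z (op T k) i →
                      IsTrimAt T _⊑_ Z i (op T k)
  open-in-star⇒trim {i} k k⊆star (w , kw , zi) = (k , ≐-refl) , λ q → above q , below q
    where
    above : ∀ q → Tset T _⊑_ Z (op T k) q → i ⊑ q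
    above q (_ , kv , zq) = star-meets⇒⊑ (k⊆star kv) zq
    below : ∀ q → i ⊑ q → Tset T _⊑_ Z (op T k) q
    below q i⊑q = ⊑⇒⊆cl i⊑q zi k kw

  trim-inside : ∀ {i w} → Z i w → (k : Ix T) → op T k w →
                ∃ λ B → IsTrimAt T _⊑_ Z i B × B w × B ⊆ op T k
  trim-inside {i} {w} zi k kw with star-open i
  ... | j , j≐star with ∩-open T k j
  ... | k′ , k′≐k∩j = op T k′ , open-in-star⇒trim k′ k′⊆star (w , k′w , zi) , k′w , k′⊆k
    where
    k′w : op T k′ w
    k′w = proj₂ k′≐k∩j (kw , proj₂ j≐star (Z⊆star i zi))
    k′⊆star : op T k′ ⊆ star i
    k′⊆star b = proj₁ j≐star (proj₂ (proj₁ k′≐k∩j b))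
    k′⊆k : op T k′ ⊆ op T k
    k′⊆k b = proj₁ (proj₁ k′≐k∩j b)

  trim-neighbourhood : ∀ w i → Z i w → ∃ λ B → IsTrimAt T _⊑_ Z i B × B w
  trim-neighbourhood w i zi =
    let u , u≐U = U-open T
        B , trim , bw , _ = trim-inside zi u (proj₂ u≐U tt)
    in B , trim , bw

  trim-base : ∀ w k → op T k w → ∃ λ B → IsTrim T _⊑_ Z B × B w × B ⊆ op T k
  trim-base w k kw = let i , zi = Z-complete w
                         B , trim , bw , B⊆k = trim-inside zi k kw
                     in B , (i , trim) , bw , B⊆k

  trim-subset : ∀ B p → IsOpen T B → Tset T _⊑_ Z B p → Hat T _⊑_ Z p →
                ∃ λ B′ → IsTrimAt T _⊑_ Z p B′ × B′ ⊆ B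
  trim-subset B p (k , k≐B) (_ , bv , zp) _ =
    let B′ , trim , _ , B′⊆k = trim-inside zp k (proj₂ k≐B bv)
    in B′ , trim , λ b → proj₁ k≐B (B′⊆k b)

  trim-sup : ∀ w p → Z p w → IsLUB T _⊑_ Z (λ q → ∃ λ B → IsTrimAt T _⊑_ Z q B × B w) p
  trim-sup w p zp = (λ { q (B , (_ , trim) , bw) → proj₁ (trim p) (w , bw , zp) })
                  , (λ r bound → bound p (trim-neighbourhood w p zp))

  trim-base⇒member : ∀ w p →
    (∀ k → op T k w → ∃ λ B → IsTrimAt T _⊑_ Z p B × B w × B ⊆ op T k) → Z p w
  -- a p-trim set around w inside star q, where w ∈ Z q, forces p ⊑ q ⊑ p
  trim-base⇒member w p base with Z-complete w
  ... | q , zq with star-open q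
  ... | j , j≐star with base j (proj₂ j≐star (Z⊆star q zq))
  ... | B , (_ , trim) , bw , B⊆j with proj₂ (trim p) (⊑-refl p)
  ... | v , bv , zp
    rewrite ⊑-antisym (proj₁ (trim q) (w , bw , zq))
                      (star-meets⇒⊑ (proj₁ j≐star (B⊆j bv)) zp) = zq

  isCompleteTrimPartition : IsCompleteTrimPartition T _⊑_ Z
  isCompleteTrimPartition =
    Z-complete , (Z-nonempty , Z-disjoint) ,
    (trim-base , trim-subset , trim-sup , trim-base⇒member) , trim-neighbourhood

≤P-antisym : ∀ {s} {p q : Carrier s} → p ≤P q → q ≤P p → p ≡ q
≤P-antisym (inj₁ p≡q) _ = p≡q
≤P-antisym (inj₂ _) (inj₁ q≡p) = sym q≡p
≤P-antisym {s} {p} {q} (inj₂ q+2≤p) (inj₂ p+2≤q) =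
  ⊥-elim (<-irrefl refl (<-≤-trans (m<m+n (idx s q) (s≤s z≤n))
                          (≤-trans q+2≤p (≤-trans (m≤m+n (idx s p) 2) p+2≤q))))

≤~-antisym : ∀ {s} {i j : Maybe (Carrier s)} → i ≤~ j → j ≤~ i → i ≡ j
≤~-antisym {i = nothing} {nothing} _ _ = refl
≤~-antisym {i = just p} {just q} p≤q q≤p = cong just (≤P-antisym p≤q q≤p)

_≤N_ : Maybe ℕ → Maybe ℕ → Set
_≤N_ = _≤~_ {pinf}

↓ : Pred (Maybe ℕ) 0ℓ → Pred (Maybe ℕ) 0ℓ
↓ Q i = ∃ λ j → Q j × i ≤N j

StabilisesTo⊥ : Pred (Maybe ℕ) 0ℓ → Set
StabilisesTo⊥ Q = ∃ λ b → ∀ k → b ≤ k → (Q (just k) → Q nothing) × (Q nothing → Q (just k))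

∁-stabilises : ∀ {Q} → StabilisesTo⊥ Q → StabilisesTo⊥ (∁ Q)
∁-stabilises (b , stable) =
  b , λ k b≤k → let to , from = stable k b≤k in (λ ¬q q → ¬q (from q)) , (λ ¬q q → ¬q (to q))

∪-stabilises : ∀ {Q R} → StabilisesTo⊥ Q → StabilisesTo⊥ R → StabilisesTo⊥ (Q ∪ R)
∪-stabilises (b , stable-Q) (c , stable-R) = b ⊔ c , λ k b⊔c≤k →
  let Q-to , Q-from = stable-Q k (≤-trans (m≤m⊔n b c) b⊔c≤k)
      R-to , R-from = stable-R k (≤-trans (m≤n⊔m b c) b⊔c≤k)
  in Sum.map Q-to R-to , Sum.map Q-from R-from

↓-stabilises : ∀ {Q} → StabilisesTo⊥ Q → StabilisesTo⊥ (↓ Q)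
↓-stabilises {Q} (b , stable) = b + 2 , λ k b+2≤k → (λ (j , q , _) → j , q , tt) , from k b+2≤k
  where
  from : ∀ k → b + 2 ≤ k → ↓ Q nothing → ↓ Q (just k)
  from k b+2≤k (nothing , q , _) = just b , proj₂ (stable b ≤-refl) q , inj₂ b+2≤k
  from k b+2≤k (just m , q , _) with m + 2 ≤? k
  ... | yes m+2≤k = just m , q , inj₂ m+2≤k
  ... | no m+2≰k = from k b+2≤k (nothing , proj₁ (stable m b≤m) q , tt)
    where
    b≤m : b ≤ m
    b≤m = <⇒≤ (+-cancelʳ-< 2 b m (≤-<-trans b+2≤k (≰⇒> m+2≰k)))

gap : ∀ {m n} → m ≤ n → ∃ λ d → d + m ≡ n
gap {m} m≤n = let d , m+d≡n = m≤n⇒∃[o]m+o≡n m≤n in d , trans (+-comm d m) m+d≡n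

module GeneratedAlgebra (em : ExcludedMiddle 0ℓ) {W : Set} (T : Topology W)
                        (A : Pred W 0ℓ) (A-open : IsOpen T A) where

  open ClosureProperties T

  private
    dne : {P : Set} → ¬ ¬ P → P
    dne = em⇒dne em

  ev : Term ⊤ → Pred W 0ℓ
  ev = evalC T A

  -- X_0 = A,  X_1 = W − cl A,  X_{k+2} = cl X_k − (cl X_{k+1} ∪ X_k)
  atomTerm : ℕ → Term ⊤
  atomTerm 0 = gen tt
  atomTerm 1 = compl (clos (gen tt))
  atomTerm (suc (suc k)) =
    compl (union (compl (clos (atomTerm k))) (union (clos (atomTerm (suc k))) (atomTerm k)))

  X : ℕ → Pred W 0ℓ
  X k = ev (atomTerm k)

  clX : ℕ → Pred W 0ℓ
  clX k = cl T (X k)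

  X-suc-open : ∀ k → IsOpen T (∁ (clX k))
  X-suc-open k = ∁-cl-open em (X k)

  X-suc-suc-intro : ∀ k {w} → clX k w → ¬ clX (suc k) w → ¬ X k w → X (suc (suc k)) w
  X-suc-suc-intro k c _ _ (inj₁ ¬c) = ¬c c
  X-suc-suc-intro k _ ¬c _ (inj₂ (inj₁ c)) = ¬c c
  X-suc-suc-intro k _ _ ¬x (inj₂ (inj₂ x)) = ¬x x

  X-suc-suc⇒clX : ∀ k {w} → X (suc (suc k)) w → clX k w
  X-suc-suc⇒clX k x = dne λ ¬c → x (inj₁ ¬c)

  X-suc-suc⇒∉clX-suc : ∀ k {w} → X (suc (suc k)) w → ¬ clX (suc k) w
  X-suc-suc⇒∉clX-suc k x c = x (inj₂ (inj₁ c))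

  X-suc-suc⇒∉X : ∀ k {w} → X (suc (suc k)) w → ¬ X k w
  X-suc-suc⇒∉X k x x′ = x (inj₂ (inj₂ x′))

  X-suc⇒∉clX : ∀ k {w} → X (suc k) w → ¬ clX k w
  X-suc⇒∉clX zero x = x
  X-suc⇒∉clX (suc k) = X-suc-suc⇒∉clX-suc k

  X⇒∉clX-suc : ∀ k {w} → X k w → ¬ clX (suc k) w
  X⇒∉clX-suc zero = open-avoids⇒cl-avoids A-open λ a x₁ → x₁ (cl-extensive a)
  X⇒∉clX-suc (suc k) x =
    open-avoids⇒cl-avoids (X-suc-open k) (λ ¬c x₂ → ¬c (X-suc-suc⇒clX k x₂)) (X-suc⇒∉clX k x)

  clX-suc-suc⊆clX : ∀ k → clX (suc (suc k)) ⊆ clX k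
  clX-suc-suc⊆clX k c = cl-idempotent (cl-monotone (X-suc-suc⇒clX k) c)

  mutual
    clX-suc-∖-clX⊆X-suc : ∀ k {w} → clX (suc k) w → ¬ clX k w → X (suc k) w
    clX-suc-∖-clX⊆X-suc zero _ ¬c = ¬c
    clX-suc-∖-clX⊆X-suc (suc k) c ¬c =
      X-suc-suc-intro k (clX-suc-suc⊆clX k c) ¬c λ x → X⇒∉clX-suc-suc k x c

    X⇒∉clX-suc-suc : ∀ k {w} → X k w → ¬ clX (suc (suc k)) w
    X⇒∉clX-suc-suc zero =
      open-avoids⇒cl-avoids A-open λ a x₂ → X-suc-suc⇒∉X 0 x₂ a
    X⇒∉clX-suc-suc (suc zero) =
      open-avoids⇒cl-avoids (X-suc-open 0) λ x₁ x₃ → X-suc-suc⇒∉X 1 x₃ x₁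
    X⇒∉clX-suc-suc (suc (suc k)) x =
      open-avoids⇒cl-avoids (X-suc-open (suc k))
        (λ ¬c x₄ → X-suc-suc⇒∉X (suc (suc k)) x₄
                     (clX-suc-∖-clX⊆X-suc (suc k) (X-suc-suc⇒clX (suc (suc k)) x₄) ¬c))
        (X-suc⇒∉clX (suc k) x)

  -- a point of X_{k+3} lies in cl X_{k+1} − X_{k+1}, hence in cl X_k
  clX-suc-suc-suc⊆clX : ∀ k → clX (suc (suc (suc k))) ⊆ clX k
  clX-suc-suc-suc⊆clX k c = cl-idempotent (cl-monotone X⊆clX c)
    where
    X⊆clX : X (suc (suc (suc k))) ⊆ clX k
    X⊆clX x = dne λ ¬c →
      X-suc-suc⇒∉X (suc k) x (clX-suc-∖-clX⊆X-suc k (X-suc-suc⇒clX (suc k) x) ¬c)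

  clX-above⊆clX : ∀ k d → clX (d + suc (suc k)) ⊆ clX k
  clX-above⊆clX k 0 = clX-suc-suc⊆clX k
  clX-above⊆clX k 1 = clX-suc-suc-suc⊆clX k
  clX-above⊆clX k (suc (suc d)) c = clX-above⊆clX k d (clX-suc-suc⊆clX (d + suc (suc k)) c)

  X⊆clX : ∀ {k j} → 2 + k ≤ j → X j ⊆ clX k
  X⊆clX {k} 2+k≤j x with gap 2+k≤j
  ... | d , refl = clX-above⊆clX k d (cl-extensive x)

  X⇒∉clX-above : ∀ i d {w} → X i w → ¬ clX (d + suc i) w
  X⇒∉clX-above i 0 = X⇒∉clX-suc i
  X⇒∉clX-above i 1 = X⇒∉clX-suc-suc i
  X⇒∉clX-above i (suc (suc d)) x c = X⇒∉clX-above i d x (clX-suc-suc⊆clX (d + suc i) c)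

  X⇒∉clX-later : ∀ {i k w} → i < k → X i w → ¬ clX k w
  X⇒∉clX-later {i} i<k x with gap i<k
  ... | d , refl = X⇒∉clX-above i d x

  X-disjoint : ∀ {i j w} → X i w → X j w → i ≡ j
  X-disjoint {i} {j} xi xj with <-cmp i j
  ... | tri< i<j _ _ = ⊥-elim (X⇒∉clX-later i<j xi (cl-extensive xj))
  ... | tri≈ _ i≡j _ = i≡j
  ... | tri> _ _ j<i = ⊥-elim (X⇒∉clX-later j<i xj (cl-extensive xi))

  Rest : Pred W 0ℓ
  Rest w = ∀ k → ¬ X k w

  Rest⊆clX-pair : ∀ k {w} → Rest w → clX k w × clX (suc k) w
  Rest⊆clX-pair zero {w} r = clA , dne λ ¬c → r 2 (X-suc-suc-intro 0 clA ¬c (r 0))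
    where
    clA : clX 0 w
    clA = dne (r 1)
  Rest⊆clX-pair (suc k) r =
    let _ , c = Rest⊆clX-pair k r
    in c , dne λ ¬c → r (3 + k) (X-suc-suc-intro (suc k) c ¬c (r (suc k)))

  Rest⊆clX : ∀ k → Rest ⊆ clX k
  Rest⊆clX k r = proj₁ (Rest⊆clX-pair k r)

  Rest⇒X-nonempty : ∀ {w} → Rest w → ∀ k → Satisfiable (X k)
  Rest⇒X-nonempty r k = cl⇒satisfiable (Rest⊆clX k r)

  Y : Maybe ℕ → Pred W 0ℓ
  Y nothing = Rest
  Y (just k) = X k

  Y-disjoint : ∀ i j {w} → Y i w → Y j w → i ≡ j
  Y-disjoint nothing nothing _ _ = refl
  Y-disjoint nothing (just k) r x = ⊥-elim (r k x)
  Y-disjoint (just k) nothing x r = ⊥-elim (r k x)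
  Y-disjoint (just k) (just l) x y = cong just (X-disjoint x y)

  Y-cover : ∀ w → ∃ λ i → Y i w
  Y-cover w with em {∃ λ k → X k w}
  ... | yes (k , x) = just k , x
  ... | no ∄ = nothing , λ k x → ∄ (k , x)

  Y-≤⇒⊆cl : ∀ i j → i ≤N j → Y i ⊆ cl T (Y j)
  Y-≤⇒⊆cl nothing nothing _ = cl-extensive
  Y-≤⇒⊆cl nothing (just n) _ = Rest⊆clX n
  Y-≤⇒⊆cl (just _) (just _) (inj₁ refl) = cl-extensive
  Y-≤⇒⊆cl (just a) (just b) (inj₂ b+2≤a) = X⊆clX (subst (_≤ a) (+-comm b 2) b+2≤a)

  star : Maybe ℕ → Pred W 0ℓ
  star nothing = U
  star (just zero) = A
  star (just (suc k)) = ∁ (clX k)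

  star-open : ∀ i → IsOpen T (star i)
  star-open nothing = U-open T
  star-open (just zero) = A-open
  star-open (just (suc k)) = X-suc-open k

  Y⊆star : ∀ i → Y i ⊆ star i
  Y⊆star nothing _ = tt
  Y⊆star (just zero) x = x
  Y⊆star (just (suc k)) = X-suc⇒∉clX k

  star-meets⇒≤ : ∀ i j {w} → star i w → Y j w → i ≤N j
  star-meets⇒≤ nothing _ _ _ = tt
  star-meets⇒≤ (just zero) nothing a r = ⊥-elim (r 0 a)
  star-meets⇒≤ (just zero) (just n) a x = inj₁ (X-disjoint a x)
  star-meets⇒≤ (just (suc k)) nothing ¬c r = ⊥-elim (¬c (Rest⊆clX k r))
  star-meets⇒≤ (just (suc k)) (just n) ¬c x with <-cmp n k
  ... | tri< n<k _ _ = inj₂ (subst (_≤ suc k) (+-comm 2 n) (s≤s n<k))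
  ... | tri≈ _ refl _ = ⊥-elim (¬c (cl-extensive x))
  ... | tri> _ _ k<n with m≤n⇒m<n∨m≡n k<n
  ...   | inj₁ 1+k<n = ⊥-elim (¬c (X⊆clX 1+k<n x))
  ...   | inj₂ 1+k≡n = inj₁ 1+k≡n

  σ : Term ⊤ → Pred (Maybe ℕ) 0ℓ
  σ = eval ↓ λ _ → ｛ just 0 ｝

  ⟦_⟧ : Pred (Maybe ℕ) 0ℓ → Pred W 0ℓ
  ⟦ Q ⟧ w = ∃ λ i → Q i × Y i w

  ⟦⟧-∁ : ∀ Q → ∁ ⟦ Q ⟧ ≐ ⟦ ∁ Q ⟧
  ⟦⟧-∁ Q = to , from
    where
    to : ∁ ⟦ Q ⟧ ⊆ ⟦ ∁ Q ⟧
    to {w} w∉ = let i , yi = Y-cover w in i , (λ q → w∉ (i , q , yi)) , yi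
    from : ⟦ ∁ Q ⟧ ⊆ ∁ ⟦ Q ⟧
    from (i , ¬q , yi) (j , q , yj) with Y-disjoint i j yi yj
    ... | refl = ¬q q

  ⟦⟧-∪ : ∀ Q R → ⟦ Q ⟧ ∪ ⟦ R ⟧ ≐ ⟦ Q ∪ R ⟧
  ⟦⟧-∪ Q R = (λ { (inj₁ (i , q , y)) → i , inj₁ q , y ; (inj₂ (i , r , y)) → i , inj₂ r , y })
           , (λ { (i , inj₁ q , y) → inj₁ (i , q , y) ; (i , inj₂ r , y) → inj₂ (i , r , y) })

  ⟦⟧-cl : ∀ Q → cl T ⟦ Q ⟧ ≐ ⟦ ↓ Q ⟧
  ⟦⟧-cl Q = to , from
    where
    to : cl T ⟦ Q ⟧ ⊆ ⟦ ↓ Q ⟧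
    to {w} c with Y-cover w
    ... | i , yi with star-open i
    ... | k , k≐star with c k (proj₂ k≐star (Y⊆star i yi))
    ... | v , kv , (j , q , yj) = i , (j , q , star-meets⇒≤ i j (proj₁ k≐star kv) yj) , yi
    from : ⟦ ↓ Q ⟧ ⊆ cl T ⟦ Q ⟧
    from (i , (j , q , i≤j) , yi) = cl-monotone (λ yj → j , q , yj) (Y-≤⇒⊆cl i j i≤j yi)

  ev≐⟦σ⟧ : ∀ t → ev t ≐ ⟦ σ t ⟧
  ev≐⟦σ⟧ (gen _) = (λ a → just 0 , refl , a) , λ { (_ , refl , a) → a }
  ev≐⟦σ⟧ zero = (λ ()) , λ { (_ , () , _) }
  ev≐⟦σ⟧ (compl t) = ≐-trans (∁-resp-≐ (ev≐⟦σ⟧ t)) (⟦⟧-∁ (σ t))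
  ev≐⟦σ⟧ (union t u) = ≐-trans (∪-resp-≐ (ev≐⟦σ⟧ t) (ev≐⟦σ⟧ u)) (⟦⟧-∪ (σ t) (σ u))
  ev≐⟦σ⟧ (clos t) = ≐-trans (cl-resp-≐ (ev≐⟦σ⟧ t)) (⟦⟧-cl (σ t))

  σ-stabilises : ∀ t → StabilisesTo⊥ (σ t)
  σ-stabilises (gen _) = 1 , λ { (suc k) _ → (λ ()) , (λ ()) }
  σ-stabilises zero = 0 , λ _ _ → (λ ()) , (λ ())
  σ-stabilises (compl t) = ∁-stabilises {σ t} (σ-stabilises t)
  σ-stabilises (union t u) = ∪-stabilises {σ t} {σ u} (σ-stabilises t) (σ-stabilises u)
  σ-stabilises (clos t) = ↓-stabilises {σ t} (σ-stabilises t)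

  X-atom : ∀ k → Satisfiable (X k) → IsAtom {G = ⊤} (cl T) (λ _ → A) (X k)
  X-atom k X-nonempty = (atomTerm k , ≐-refl) , X-nonempty , inside
    where
    inside : ∀ t → ev t ⊆ X k → Empty (ev t) ⊎ X k ⊆ ev t
    inside t t⊆X with em {σ t (just k)}
    ... | yes q = inj₂ λ x → proj₂ (ev≐⟦σ⟧ t) (just k , q , x)
    ... | no ¬q = inj₁ λ w e → let j , q , yj = proj₁ (ev≐⟦σ⟧ t) e in
                     ¬q (subst (σ t) (Y-disjoint j (just k) yj (t⊆X e)) q)

  -- an atom meeting Rest would contain all p_k for large k, hence some nonempty X_k
  Ainf≐Rest : Ainf T A ≐ Rest
  Ainf≐Rest = to , from
    where
    to : Ainf T A ⊆ Rest
    to a k x = a (atomTerm k , X-atom k (_ , x) , x)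
    from : Rest ⊆ Ainf T A
    from r (t , (_ , _ , minimal) , e) with proj₁ (ev≐⟦σ⟧ t) e
    ... | just k , _ , x = r k x
    ... | nothing , q , _ with σ-stabilises t
    ... | b , stable with minimal (atomTerm b)
                            (λ x → proj₂ (ev≐⟦σ⟧ t) (just b , proj₂ (stable b ≤-refl) q , x))
    ... | inj₁ X-empty = let v , x = Rest⇒X-nonempty r b in X-empty v x
    ... | inj₂ t⊆X = r b (t⊆X e)

  Enumerates : Shape → Set
  Enumerates s = (∀ p → Satisfiable (X (idx s p))) ×
                 (∀ n → Satisfiable (X n) → ∃ λ p → idx s p ≡ n) ×
                 (∀ p q → idx s p ≡ idx s q → p ≡ q)

  module Enumeration (s : Shape) (enumerates : Enumerates s) where

    e : Carrier s → ℕ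
    e = idx s

    X-e-nonempty : ∀ p → Satisfiable (X (e p))
    X-e-nonempty = proj₁ enumerates

    e-onto : ∀ n → Satisfiable (X n) → ∃ λ p → e p ≡ n
    e-onto = proj₁ (proj₂ enumerates)

    e-injective : ∀ p q → e p ≡ e q → p ≡ q
    e-injective = proj₂ (proj₂ enumerates)

    f : Pred W 0ℓ → Pred (Carrier s) 0ℓ
    f Z p = Satisfiable (Z ∩ X (e p))

    f-monotone : ∀ {Z Z′} → Z ⊆ Z′ → f Z ⊆ f Z′
    f-monotone Z⊆Z′ = map₂ (Product.map₁ Z⊆Z′)

    f-resp-≐ : ∀ {Z Z′} → Z ≐ Z′ → f Z ≐ f Z′
    f-resp-≐ (Z⊆Z′ , Z′⊆Z) = f-monotone Z⊆Z′ , f-monotone Z′⊆Z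

    f-∪ : ∀ Z Z′ → f (Z ∪ Z′) ≐ f Z ∪ f Z′
    f-∪ Z Z′ = (λ { (v , inj₁ z , x) → inj₁ (v , z , x) ; (v , inj₂ z , x) → inj₂ (v , z , x) })
             , (λ { (inj₁ (v , z , x)) → v , inj₁ z , x ; (inj₂ (v , z , x)) → v , inj₂ z , x })

    f-X : ∀ k → f (X k) ≐ λ p → e p ≡ k
    f-X k = (λ (_ , x , x′) → X-disjoint x′ x)
          , λ { refl → let v , x = X-e-nonempty _ in v , x , x }

    σ↾ : Term ⊤ → Pred (Carrier s) 0ℓ
    σ↾ t p = σ t (just (e p))

    f-ev : ∀ t → f (ev t) ≐ σ↾ t
    f-ev t = to , from
      where
      to : f (ev t) ⊆ σ↾ t
      to {p} (_ , et , x) = let j , q , yj = proj₁ (ev≐⟦σ⟧ t) et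
                            in subst (σ t) (Y-disjoint j (just (e p)) yj x) q
      from : σ↾ t ⊆ f (ev t)
      from {p} q = let v , x = X-e-nonempty p in v , proj₂ (ev≐⟦σ⟧ t) (just (e p) , q , x) , x

    f-term : ∀ {Z} t → ev t ≐ Z → f Z ≐ σ↾ t
    f-term t t≐Z = ≐-trans (f-resp-≐ (≐-sym t≐Z)) (f-ev t)

    ≤P⇒≤N : ∀ {p q} → p ≤P q → just (e p) ≤N just (e q)
    ≤P⇒≤N (inj₁ refl) = inj₁ refl
    ≤P⇒≤N (inj₂ e-q+2≤e-p) = inj₂ e-q+2≤e-p

    ≤N⇒≤P : ∀ {p q} → just (e p) ≤N just (e q) → p ≤P q
    ≤N⇒≤P (inj₁ e-p≡e-q) = inj₁ (e-injective _ _ e-p≡e-q)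
    ≤N⇒≤P (inj₂ e-q+2≤e-p) = inj₂ e-q+2≤e-p

    σ↾-clos : ∀ t → σ↾ (clos t) ≐ down (σ↾ t)
    σ↾-clos t = to , from
      where
      to : σ↾ (clos t) ⊆ down (σ↾ t)
      to {p} (just n , q , p≤n) with X-e-nonempty p
      ... | v , x with e-onto n (cl⇒satisfiable (Y-≤⇒⊆cl (just (e p)) (just n) p≤n x))
      ... | p′ , refl = p′ , q , ≤N⇒≤P p≤n
      from : down (σ↾ t) ⊆ σ↾ (clos t)
      from (q , σq , p≤q) = just (e q) , σq , ≤P⇒≤N p≤q

    down-monotone : ∀ {Q R : Pred (Carrier s) 0ℓ} → Q ⊆ R → down Q ⊆ down R
    down-monotone Q⊆R = map₂ (Product.map₁ Q⊆R)

    down-resp-≐ : ∀ {Q R : Pred (Carrier s) 0ℓ} → Q ≐ R → down Q ≐ down R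
    down-resp-≐ (Q⊆R , R⊆Q) = down-monotone Q⊆R , down-monotone R⊆Q

    f-∁ : ∀ Z → InC T A Z → f (∁ Z) ≐ ∁ (f Z)
    f-∁ Z (t , t≐Z) = ≐-trans (f-term (compl t) (∁-resp-≐ t≐Z)) (∁-resp-≐ (≐-sym (f-term t t≐Z)))

    f-cl : ∀ Z → InC T A Z → f (cl T Z) ≐ down (f Z)
    f-cl Z (t , t≐Z) =
      ≐-trans (f-term (clos t) (cl-resp-≐ t≐Z))
              (≐-trans (σ↾-clos t) (down-resp-≐ (≐-sym (f-term t t≐Z))))

    LowerSet : Set₁
    LowerSet = Σ (Pred (Carrier s) 0ℓ) IsLower

    evE : Term LowerSet → Pred (Carrier s) 0ℓ
    evE = eval down proj₁

    -- p₀ is maximal, so the complement of ｛ p₀ ｝ is a lower set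
    not-p₀ : LowerSet
    not-p₀ = (λ p → ¬ e p ≡ 0) , lower
      where
      lower : IsLower (λ p → ¬ e p ≡ 0)
      lower p q e-q≢0 (inj₁ refl) = e-q≢0
      lower p q _ (inj₂ e-q+2≤e-p) e-p≡0
        with m+n≤o⇒n≤o (e q) (subst (e q + 2 ≤_) e-p≡0 e-q+2≤e-p)
      ... | ()

    τ : Term ⊤ → Term LowerSet
    τ (gen _) = compl (gen not-p₀)
    τ zero = zero
    τ (compl t) = compl (τ t)
    τ (union t u) = union (τ t) (τ u)
    τ (clos t) = clos (τ t)

    τ-correct : ∀ t → evE (τ t) ≐ σ↾ t
    τ-correct (gen _) = (λ ¬¬0 → cong just (sym (dne ¬¬0)))
                      , (λ eq ¬0 → ¬0 (sym (just-injective eq)))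
    τ-correct zero = ≐-refl
    τ-correct (compl t) = ∁-resp-≐ (τ-correct t)
    τ-correct (union t u) = ∪-resp-≐ (τ-correct t) (τ-correct u)
    τ-correct (clos t) = ≐-trans (down-resp-≐ (τ-correct t)) (≐-sym (σ↾-clos t))

    f-into : ∀ Z → InC T A Z → InE s (f Z)
    f-into Z (t , t≐Z) = τ t , ≐-trans (τ-correct t) (≐-sym (f-term t t≐Z))

    σ↾-X : ∀ k → σ↾ (atomTerm k) ≐ λ p → e p ≡ k
    σ↾-X k = ≐-trans (≐-sym (f-ev (atomTerm k))) (f-X k)

    -- every lower set L is the down-closure of its elements of index below e p₀ + 2
    -- for any p₀ ∈ L, since each p of larger index lies below p₀
    module Realise (L : Pred (Carrier s) 0ℓ) (L-lower : IsLower L) where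

      atomIf : ∀ n → Dec (∃ λ q → e q ≡ n × L q) → Term ⊤
      atomIf n (yes _) = atomTerm n
      atomIf n (no _) = zero

      σ↾-atomIf : ∀ n d → σ↾ (atomIf n d) ≐ λ p → e p ≡ n × L p
      σ↾-atomIf n (yes (q , e-q≡n , Lq)) = to , λ (e-p≡n , _) → proj₂ (σ↾-X n) e-p≡n
        where
        to : σ↾ (atomTerm n) ⊆ λ p → e p ≡ n × L p
        to {p} σp = let e-p≡n = proj₁ (σ↾-X n) σp
                    in e-p≡n , subst L (e-injective q p (trans e-q≡n (sym e-p≡n))) Lq
      σ↾-atomIf n (no ∄) = (λ ()) , λ {p} (e-p≡n , Lp) → ⊥-elim (∄ (p , e-p≡n , Lp))

      atomsBelow : ℕ → Term ⊤
      atomsBelow zero = zero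
      atomsBelow (suc n) = union (atomsBelow n) (atomIf n em)

      σ↾-atomsBelow : ∀ n → σ↾ (atomsBelow n) ≐ λ p → e p < n × L p
      σ↾-atomsBelow zero = (λ ()) , λ ()
      σ↾-atomsBelow (suc n) = to , from
        where
        to : σ↾ (atomsBelow (suc n)) ⊆ λ p → e p < suc n × L p
        to (inj₁ σp) = Product.map₁ m<n⇒m<1+n (proj₁ (σ↾-atomsBelow n) σp)
        to (inj₂ σp) = Product.map₁ (λ e-p≡n → s≤s (≤-reflexive e-p≡n)) (proj₁ (σ↾-atomIf n em) σp)
        from : (λ p → e p < suc n × L p) ⊆ σ↾ (atomsBelow (suc n))
        from (e-p<1+n , Lp) with m<1+n⇒m<n∨m≡n e-p<1+n
        ... | inj₁ e-p<n = inj₁ (proj₂ (σ↾-atomsBelow n) (e-p<n , Lp))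
        ... | inj₂ e-p≡n = inj₂ (proj₂ (σ↾-atomIf n em) (e-p≡n , Lp))

      realise : ∃ λ t → σ↾ t ≐ L
      realise with em {Satisfiable L}
      ... | no ∄ = zero , (λ ()) , λ Lp → ∄ (_ , Lp)
      ... | yes (p₀ , Lp₀) =
        clos (atomsBelow bound) ,
        ≐-trans (σ↾-clos (atomsBelow bound))
                (≐-trans (down-resp-≐ (σ↾-atomsBelow bound)) (to , from))
        where
        bound : ℕ
        bound = e p₀ + 2
        to : down (λ p → e p < bound × L p) ⊆ L
        to {p} (q , (_ , Lq) , p≤q) = L-lower p q Lq p≤q
        from : L ⊆ down (λ p → e p < bound × L p)
        from {p} Lp with e p <? bound
        ... | yes e-p<bound = p , (e-p<bound , Lp) , inj₁ refl
        ... | no e-p≮bound = p₀ , (m<m+n (e p₀) (s≤s z≤n) , Lp₀) , inj₂ (≮⇒≥ e-p≮bound)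

    σ↾-onto : ∀ u → ∃ λ t → σ↾ t ≐ evE u
    σ↾-onto (gen (L , L-lower)) = Realise.realise L L-lower
    σ↾-onto zero = zero , ≐-refl
    σ↾-onto (compl u) = let t , h = σ↾-onto u in compl t , ∁-resp-≐ h
    σ↾-onto (union u v) =
      let t , h = σ↾-onto u
          t′ , h′ = σ↾-onto v
      in union t t′ , ∪-resp-≐ h h′
    σ↾-onto (clos u) = let t , h = σ↾-onto u in clos t , ≐-trans (σ↾-clos t) (down-resp-≐ h)

    f-onto : ∀ Q → InE s Q → ∃ λ Z → InC T A Z × f Z ≐ Q
    f-onto Q (u , u≐Q) =
      let t , h = σ↾-onto u in ev t , (t , ≐-refl) , ≐-trans (f-ev t) (≐-trans h u≐Q)

    -- a point of Rest lies in ev t exactly when all p_k of large index lie in σ t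
    σ↾-reflects-⊆ : ∀ t u → σ↾ t ⊆ σ↾ u → ev t ⊆ ev u
    σ↾-reflects-⊆ t u t⊆u {w} et with proj₁ (ev≐⟦σ⟧ t) et
    ... | just n , q , x with e-onto n (w , x)
    ...   | p , refl = proj₂ (ev≐⟦σ⟧ u) (just (e p) , t⊆u q , x)
    σ↾-reflects-⊆ t u t⊆u {w} et | nothing , q , r
      with σ-stabilises t | σ-stabilises u
    ... | b , stable-t | c , stable-u with e-onto (b ⊔ c) (Rest⇒X-nonempty r (b ⊔ c))
    ...   | p , e-p≡b⊔c = proj₂ (ev≐⟦σ⟧ u) (nothing , proj₁ (stable-u (e p) c≤e-p) σu-p , r)
      where
      b≤e-p : b ≤ e p
      b≤e-p = subst (b ≤_) (sym e-p≡b⊔c) (m≤m⊔n b c)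
      c≤e-p : c ≤ e p
      c≤e-p = subst (c ≤_) (sym e-p≡b⊔c) (m≤n⊔m b c)
      σu-p : σ↾ u p
      σu-p = t⊆u (proj₂ (stable-t (e p) b≤e-p) q)

    f-injective : ∀ Z Z′ → InC T A Z → InC T A Z′ → f Z ≐ f Z′ → Z ≐ Z′
    f-injective Z Z′ (t , t≐Z) (u , u≐Z′) fZ≐fZ′ =
      ≐-trans (≐-sym t≐Z)
              (≐-trans (σ↾-reflects-⊆ t u (proj₁ σt≐σu) , σ↾-reflects-⊆ u t (proj₂ σt≐σu)) u≐Z′)
      where
      σt≐σu : σ↾ t ≐ σ↾ u
      σt≐σu = ≐-trans (≐-sym (f-term t t≐Z)) (≐-trans fZ≐fZ′ (f-term u u≐Z′))

    f-isCAIso : IsCAIso T A s f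
    f-isCAIso = record
      { into    = f-into
      ; resp    = λ _ _ _ _ → f-resp-≐
      ; inj     = f-injective
      ; surj    = f-onto
      ; pres-∪  = λ Z Z′ _ _ → f-∪ Z Z′
      ; pres-∁  = f-∁
      ; pres-cl = f-cl
      }

    f-X-e : ∀ p → InC T A (X (e p)) × f (X (e p)) ≐ ｛ p ｝
    f-X-e p = (atomTerm (e p) , ≐-refl)
            , (λ fq → e-injective p _ (sym (proj₁ (f-X (e p)) fq)))
            , (λ { refl → proj₂ (f-X (e p)) refl })

    X-e-trimPartition : Empty Rest → IsCompleteTrimPartition T (_≤P_ {s}) (λ p → X (e p))
    X-e-trimPartition no-rest =
      TrimCriterion.isCompleteTrimPartition T _≤P_ (λ p → X (e p)) X-e-nonempty complete ≤P-antisym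
        (λ p → star (just (e p))) (λ p → star-open (just (e p))) (λ p → Y⊆star (just (e p)))
        (λ {p} {q} sw x → ≤N⇒≤P (star-meets⇒≤ (just (e p)) (just (e q)) sw x))
        (λ {p} {q} p≤q → Y-≤⇒⊆cl (just (e p)) (just (e q)) (≤P⇒≤N p≤q))
      where
      complete : ∀ w → ∃ λ p → X (e p) w
      complete w with Y-cover w
      ... | nothing , r = ⊥-elim (no-rest w r)
      ... | just n , x with e-onto n (w , x)
      ...   | p , refl = p , x

  extend-≐-Y : ∀ i → extend {pinf} X (Ainf T A) i ≐ Y i
  extend-≐-Y nothing = Ainf≐Rest
  extend-≐-Y (just k) = ≐-refl

  extend-X-trimPartition : Satisfiable Rest →
                           IsCompleteTrimPartition T _≤N_ (extend {pinf} X (Ainf T A))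
  extend-X-trimPartition (w , r) =
    TrimCriterion.isCompleteTrimPartition T _≤N_ Z nonempty complete ≤~-antisym star star-open
      (λ i z → Y⊆star i (proj₁ (extend-≐-Y i) z))
      (λ {i} {j} sw z → star-meets⇒≤ i j sw (proj₁ (extend-≐-Y j) z))
      (λ {i} {j} i≤j z →
        cl-monotone (proj₂ (extend-≐-Y j)) (Y-≤⇒⊆cl i j i≤j (proj₁ (extend-≐-Y i) z)))
    where
    Z : Maybe ℕ → Pred W 0ℓ
    Z = extend X (Ainf T A)
    nonempty : ∀ i → Satisfiable (Z i)
    nonempty nothing = w , proj₂ Ainf≐Rest r
    nonempty (just k) = Rest⇒X-nonempty r k
    complete : ∀ v → ∃ λ i → Z i v
    complete v = let i , y = Y-cover v in i , proj₂ (extend-≐-Y i) y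

  Ainf-trimPartition : ∀ s → (Satisfiable Rest → s ≡ pinf) → Satisfiable (Ainf T A) →
    (s ≡ pinf) × IsCompleteTrimPartition T (_≤~_ {s}) (extend (λ p → X (idx s p)) (Ainf T A))
  Ainf-trimPartition s rest⇒pinf (w , a) with rest⇒pinf (w , proj₁ Ainf≐Rest a)
  ... | refl = refl , extend-X-trimPartition (w , proj₁ Ainf≐Rest a)

  nonempty-X-index : ∀ m {n} → ¬ Satisfiable (X (suc m)) → Satisfiable (X n) →
                     n ≤ m ⊎ n ≡ suc (suc m)
  nonempty-X-index m {n} X-empty (w , x) with n ≤? m
  ... | yes n≤m = inj₁ n≤m
  ... | no n≰m with m≤n⇒m<n∨m≡n (≰⇒> n≰m)
  ...   | inj₂ refl = ⊥-elim (X-empty (w , x))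
  ...   | inj₁ 2+m≤n with m≤n⇒m<n∨m≡n 2+m≤n
  ...     | inj₂ 2+m≡n = inj₂ (sym 2+m≡n)
  ...     | inj₁ 3+m≤n = ⊥-elim (X-empty (cl⇒satisfiable (X⊆clX 3+m≤n x)))

  pinf-enumerates : (∀ k → Satisfiable (X k)) → Enumerates pinf
  pinf-enumerates X-nonempty = X-nonempty , (λ n _ → n , refl) , λ _ _ eq → eq

  module FirstGap (m : ℕ) (initial : ∀ j → j ≤ m → Satisfiable (X j))
                  (X-empty : ¬ Satisfiable (X (suc m))) where

    toℕ≤m : ∀ (i : Fin (suc m)) → toℕ i ≤ m
    toℕ≤m i = ≤-pred (toℕ<n i)

    n0-enumerates : ¬ Satisfiable (X (suc (suc m))) → Enumerates (pfin m n0)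
    n0-enumerates X-empty₂ = (λ i → initial (toℕ i) (toℕ≤m i)) , onto , λ _ _ → toℕ-injective
      where
      onto : ∀ n → Satisfiable (X n) → ∃ λ (i : Fin (suc m)) → toℕ i ≡ n
      onto n sat with nonempty-X-index m X-empty sat
      ... | inj₁ n≤m = fromℕ< (s≤s n≤m) , toℕ-fromℕ< (s≤s n≤m)
      ... | inj₂ refl = ⊥-elim (X-empty₂ sat)

    n2-enumerates : Satisfiable (X (suc (suc m))) → Enumerates (pfin m n2)
    n2-enumerates X-nonempty₂ = nonempty , onto , injective
      where
      nonempty : ∀ p → Satisfiable (X (idx (pfin m n2) p))
      nonempty (just i) = initial (toℕ i) (toℕ≤m i)
      nonempty nothing = X-nonempty₂
      onto : ∀ n → Satisfiable (X n) → ∃ λ p → idx (pfin m n2) p ≡ n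
      onto n sat with nonempty-X-index m X-empty sat
      ... | inj₁ n≤m = just (fromℕ< (s≤s n≤m)) , toℕ-fromℕ< (s≤s n≤m)
      ... | inj₂ refl = nothing , refl
      toℕ≢2+m : ∀ (i : Fin (suc m)) → ¬ toℕ i ≡ suc (suc m)
      toℕ≢2+m i eq = <-irrefl refl (≤-trans (n≤1+n (suc m)) (subst (_≤ m) eq (toℕ≤m i)))
      injective : ∀ p q → idx (pfin m n2) p ≡ idx (pfin m n2) q → p ≡ q
      injective (just i) (just j) eq = cong just (toℕ-injective eq)
      injective (just i) nothing eq = ⊥-elim (toℕ≢2+m i eq)
      injective nothing (just j) eq = ⊥-elim (toℕ≢2+m j (sym eq))
      injective nothing nothing _ = refl

    no-rest : ∀ {s} → Satisfiable Rest → s ≡ pinf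
    no-rest (_ , r) = ⊥-elim (X-empty (Rest⇒X-nonempty r (suc m)))

    enumeration : ∃ λ s → Enumerates s × (Satisfiable Rest → s ≡ pinf)
    enumeration with em {Satisfiable (X (suc (suc m)))}
    ... | yes X-nonempty₂ = pfin m n2 , n2-enumerates X-nonempty₂ , no-rest
    ... | no X-empty₂ = pfin m n0 , n0-enumerates X-empty₂ , no-rest

  enumeration : Satisfiable A → ∃ λ s → Enumerates s × (Satisfiable Rest → s ≡ pinf)
  enumeration A-nonempty with em {∀ k → Satisfiable (X k)}
  ... | yes X-nonempty = pinf , pinf-enumerates X-nonempty , λ _ → refl
  ... | no ¬all with dne (λ ∄ → ¬all λ k → dne λ X-empty → ∄ (k , X-empty))
  ... | k , X-empty with all-upto-or-first-gap (λ k → Satisfiable (X k)) (λ _ → em) A-nonempty k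
  ...   | inj₁ all-upto = ⊥-elim (X-empty (all-upto k ≤-refl))
  ...   | inj₂ (m , initial , gap) = FirstGap.enumeration m initial gap

theorem7p2 : ExcludedMiddle 0ℓ →
    (W : Set) (T : Topology W) (A : Pred W 0ℓ) →
    IsOpen T A → Satisfiable A →
    Σ Shape λ s →
    Σ (Pred W 0ℓ → Pred (Carrier s) 0ℓ) λ f →
    IsCAIso T A s f ×
    Σ (Carrier s → Pred W 0ℓ) λ X →
      ((p : Carrier s) → InC T A (X p) × (f (X p) ≐ ｛ p ｝)) ×
      (Empty (Ainf T A) →
        IsCompleteTrimPartition T (_≤P_ {s}) X) ×
      (Satisfiable (Ainf T A) →
        (s ≡ pinf) × IsCompleteTrimPartition T (_≤~_ {s}) (extend X (Ainf T A)))
theorem7p2 em W T A A-open A-nonempty with GeneratedAlgebra.enumeration em T A A-open A-nonempty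
... | s , enumerates , rest⇒pinf =
  s , f , f-isCAIso , (λ p → X (idx s p)) , f-X-e ,
  (λ no-Ainf → X-e-trimPartition λ w r → no-Ainf w (proj₂ Ainf≐Rest r)) ,
  Ainf-trimPartition s rest⇒pinf
  where
  open GeneratedAlgebra em T A A-open
  open Enumeration s enumerates
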